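{- Let $G$ be a commutative semigroup, $\kappa:=|G|$, $n$ a positive integer, and $\lambda,\theta$ cardinals. If $G\nrightarrow[\lambda]^{\mathrm{FS}_n}_\theta$ holds, then $\kappa\nrightarrow[\lambda]^n_\theta$ holds.
   Context: For a commutative semigroup $G$, $\mathrm{FS}_n(X):=\{x_1+\cdots+x_n\mid x_1,\ldots,x_n\in X \text{ pairwise distinct}\}$, and $G\nrightarrow[\lambda]^{\mathrm{FS}_n}_\theta$ means there is a colouring $c:G\rightarrow\theta$ such that $c[\mathrm{FS}_n(X)]=\theta$ for every $X\subseteq G$ with $|X|=\lambda$. $\kappa\nrightarrow[\lambda]^n_\theta$ means there is a colouring $d:[\kappa]^n\rightarrow\theta$ of the $n$-element subsets of $\kappa$ such that $d[[Y]^n]=\theta$ for every $Y\subseteq\kappa$ with $|Y|=\lambda$. -}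

module Defs where

open import Data.Nat using (ℕ; zero; suc; NonZero)
open import Data.Fin using (Fin; zero; suc)
open import Data.Fin.Permutation using (Permutation′; _⟨$⟩ʳ_)
open import Data.Product using (Σ; ∃; _×_)
open import Function using (_∘_)
open import Function.Definitions using (Injective)
open import Relation.Binary.PropositionalEquality using (_≡_)

sumFin : {A : Set} → (A → A → A) → (n : ℕ) → .{{_ : NonZero n}} → (Fin n → A) → A
sumFin _∙_ (suc zero) f = f zero
sumFin _∙_ (suc (suc k)) f = f zero ∙ sumFin _∙_ (suc k) (f ∘ suc)

-- G ↛ [λ]^{FS_n}_θ  (λ = |Λ|, θ = |Θ|):
-- some c : G → Θ such that for every X ⊆ G with |X| = λ (X = image of an
-- injection f : Λ → G), every colour t is attained on FS_n(X), i.e. on a sum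
-- f(a₀)+⋯+f(aₙ₋₁) with a₀,…,aₙ₋₁ pairwise distinct.
FSNegArrow : (G : Set) → (G → G → G) → (n : ℕ) → .{{_ : NonZero n}} → (Λ Θ : Set) → Set
FSNegArrow G _∙_ n Λ Θ =
  Σ (G → Θ) λ c →
    (f : Λ → G) → Injective _≡_ _≡_ f →
    (t : Θ) → ∃ λ (a : Fin n → Λ) → Injective _≡_ _≡_ a × c (sumFin _∙_ n (f ∘ a)) ≡ t

-- A colouring of [K]^n: a function on injective n-tuples of K that does not
-- depend on the order of enumeration (these correspond exactly to functions
-- on n-element subsets of K).
IsSetColouring : (K : Set) (n : ℕ) (Θ : Set) → ((Fin n → K) → Θ) → Set
IsSetColouring K n Θ d =
  (s : Fin n → K) → Injective _≡_ _≡_ s →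
  (σ : Permutation′ n) → d (s ∘ (σ ⟨$⟩ʳ_)) ≡ d s

-- κ ↛ [λ]^n_θ  (κ = |K|): some colouring d of [K]^n such that for every
-- Y ⊆ K with |Y| = λ (Y = image of an injection g : Λ → K), every colour
-- is attained on [Y]^n.
NegArrow : (K : Set) (n : ℕ) (Λ Θ : Set) → Set
NegArrow K n Λ Θ =
  Σ ((Fin n → K) → Θ) λ d →
    IsSetColouring K n Θ d ×
    ((g : Λ → K) → Injective _≡_ _≡_ g →
     (t : Θ) → ∃ λ (a : Fin n → Λ) → Injective _≡_ _≡_ a × d (g ∘ a) ≡ t)

-- Colour an n-tuple of G by the colour of its sum. Commutativity makes the sum,
-- hence the colour, independent of the order of the tuple, so this is a colouring
-- of [G]^n; an injective tuple of elements of X has its sum in FS_n(X), so every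
-- colour is attained on [X]^n. Finally κ ↛ [λ]^n_θ only gets easier for smaller κ.
module Submission where

open import Defs
open import Data.Nat using (ℕ; NonZero; zero; suc)
open import Data.Fin using (Fin; zero; suc)
open import Data.Fin.Permutation using (Permutation′; _⟨$⟩ʳ_)
open import Data.Product using (_,_)
open import Function using (_∘_)
open import Function.Bundles using (_↔_; _↣_; Injection)
open import Function.Construct.Composition using (injective)
open import Function.Properties.Inverse using (↔-sym; ↔⇒↣)
open import Relation.Binary.PropositionalEquality using (_≡_; refl; cong)
open import Relation.Binary.Construct.Add.Point.Equality using (∙≈∙; [_]; [≈]-injective)
  renaming (_≈∙_ to lift≈)
open import Relation.Nullary.Construct.Add.Point using (∙; [_])
open import Algebra.Bundles using (CommutativeMonoid)
open import Algebra.Structures using (IsCommutativeSemigroup)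
open import Algebra.Definitions using (Commutative)
open import Algebra.Construct.Add.Identity using (liftOp; isMonoid)

module _ {G : Set} {_∙_ : G → G → G} (isCommSemigroup : IsCommutativeSemigroup _≡_ _∙_) where
  open IsCommutativeSemigroup isCommSemigroup using (comm; isSemigroup)

  liftOp-comm : Commutative (lift≈ _≡_) (liftOp _∙_)
  liftOp-comm [ x ] [ y ] = [ comm x y ]
  liftOp-comm [ x ] ∙     = [ refl ]
  liftOp-comm ∙     [ y ] = [ refl ]
  liftOp-comm ∙     ∙     = ∙≈∙

  -- The library proves permutation invariance of finite sums only in commutative
  -- monoids, so adjoin an identity and transport along [_].
  withIdentity : CommutativeMonoid _ _
  withIdentity = record
    { isCommutativeMonoid = record
      { isMonoid = isMonoid isSemigroup
      ; comm     = liftOp-comm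
      }
    }

  open CommutativeMonoid withIdentity using (∙-cong)
    renaming (refl to ≈-refl; trans to ≈-trans; sym to ≈-sym)
  open import Algebra.Properties.CommutativeMonoid.Sum withIdentity using (sum; sum-permute)

  sumFin≈sum : (n : ℕ) .{{_ : NonZero n}} (f : Fin n → G) →
               lift≈ _≡_ [ sumFin _∙_ n f ] (sum ([_] ∘ f))
  sumFin≈sum (suc zero)    f = ≈-refl
  sumFin≈sum (suc (suc k)) f = ∙-cong ≈-refl (sumFin≈sum (suc k) (f ∘ suc))

  sumFin-permute : (n : ℕ) .{{_ : NonZero n}} (f : Fin n → G) (σ : Permutation′ n) →
                   sumFin _∙_ n (f ∘ (σ ⟨$⟩ʳ_)) ≡ sumFin _∙_ n f
  sumFin-permute n f σ = [≈]-injective _≡_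
    (≈-trans (sumFin≈sum n (f ∘ (σ ⟨$⟩ʳ_)))
    (≈-trans (≈-sym (sum-permute ([_] ∘ f) σ))
             (≈-sym (sumFin≈sum n f))))

  fsNegArrow⇒negArrow : (n : ℕ) .{{_ : NonZero n}} (Λ Θ : Set) →
                        FSNegArrow G _∙_ n Λ Θ → NegArrow G n Λ Θ
  fsNegArrow⇒negArrow n Λ Θ (c , hits) =
    (λ s → c (sumFin _∙_ n s)) , (λ s _ σ → cong c (sumFin-permute n s σ)) , hits

negArrow-↣ : {K K′ : Set} → K′ ↣ K → (n : ℕ) (Λ Θ : Set) →
             NegArrow K n Λ Θ → NegArrow K′ n Λ Θ
negArrow-↣ ι n Λ Θ (d , setColouring , hits) =
  (d ∘ (to ∘_)) ,
  (λ s s-inj → setColouring (to ∘ s) (injective _≡_ _≡_ _≡_ s-inj ι-inj)) ,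
  (λ g g-inj → hits (to ∘ g) (injective _≡_ _≡_ _≡_ g-inj ι-inj))
  where open Injection ι renaming (injective to ι-inj)

proposition4p10 : (G : Set) (_∙_ : G → G → G) → IsCommutativeSemigroup _≡_ _∙_ →
                  (K : Set) → G ↔ K →
                  (n : ℕ) → .{{_ : NonZero n}} → (Λ Θ : Set) →
                  FSNegArrow G _∙_ n Λ Θ → NegArrow K n Λ Θ
proposition4p10 G _∙_ isCommSemigroup K G↔K n Λ Θ =
  negArrow-↣ (↔⇒↣ (↔-sym G↔K)) n Λ Θ ∘ fsNegArrow⇒negArrow isCommSemigroup n Λ Θ
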